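{- Let $(T,w)$ be a canonical weighted tree with $w(T)=n$. Then exactly one of the following holds: (1) $T$ has exactly one centroid $c$ and $\mathrm{hs}(c)<n/2$; (2) $T$ has exactly two centroids $c_1,c_2$, which are adjacent, and the removal of the edge $c_1c_2$ partitions $T$ into two subtrees $T_1,T_2$ of weight $n/2$ each; moreover every proper subtree of $T_1$ (resp. $T_2$) has weight at most $n/2-1$; (3) $T$ has exactly three centroids, with a unique central centroid $c$, $w(c)=0$, whose removal partitions $T$ into two subtrees of weight $n/2$ each.
   Context: A weighted tree is a pair $(T,w)$ with $T$ a finite tree and $w$ a non-negative integer vertex weight function with at least one positive value; $w(U)=\sum_{u\in U}w(u)$ and the weight of a subtree is the weight of its vertex set. It is canonical if its zero-weight vertices form an independent set and every leaf has positive weight. The subtrees of a vertex $v$ are the components of $T-v$; $\mathrm{hs}(v)$ is the maximum weight of a subtree of $v$ ($0$ if $T$ has one vertex); a centroid is a vertex minimizing $\mathrm{hs}$. The centroids form the vertex set of a path (the path of centroids), and a centroid is central if it is a center of this path. A proper subtree of a tree $T_1$ is a connected subgraph of $T_1$ other than $T_1$ itself. -}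

module Defs where

open import Data.Nat using (ℕ; zero; suc; _+_; _*_; _≤_; _<_)
open import Data.Fin using (Fin; zero; suc; inject₁; fromℕ)
open import Data.Bool using (Bool; true; false; if_then_else_)
open import Data.Product using (Σ; ∃; ∃-syntax; _×_; _,_)
open import Data.Sum using (_⊎_)
open import Data.Empty using (⊥)
open import Relation.Nullary using (¬_)
open import Relation.Binary.PropositionalEquality using (_≡_; _≢_)
open import Function.Definitions using (Injective)

sumFin : ∀ {m} → (Fin m → ℕ) → ℕ
sumFin {zero}  f = 0
sumFin {suc m} f = f zero + sumFin (λ i → f (suc i))

Graph : ℕ → Set
Graph m = Fin m → Fin m → Bool

VSet : ℕ → Set
VSet m = Fin m → Bool

_∈_ : ∀ {m} → Fin m → VSet m → Set
x ∈ U = U x ≡ true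

_∉_ : ∀ {m} → Fin m → VSet m → Set
x ∉ U = U x ≡ false

Adj : ∀ {m} → Graph m → Fin m → Fin m → Set
Adj G a b = G a b ≡ true

data WalkIn {m} (G : Graph m) (X : VSet m) : Fin m → Fin m → ℕ → Set where
  here : ∀ {a} → a ∈ X → WalkIn G X a a 0
  step : ∀ {a c b k} → a ∈ X → Adj G a c → WalkIn G X c b k → WalkIn G X a b (suc k)

full : ∀ {m} → VSet m
full _ = true

ConnectedIn : ∀ {m} → Graph m → VSet m → Set
ConnectedIn G X = ∀ a b → a ∈ X → b ∈ X → ∃[ k ] WalkIn G X a b k

-- a cycle: j+3 distinct vertices, cyclically consecutive ones adjacent
HasCycle : ∀ {m} → Graph m → Set
HasCycle {m} G = ∃[ j ] Σ (Fin (suc (suc (suc j))) → Fin m) λ f →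
  Injective _≡_ _≡_ f
  × (∀ (i : Fin (suc (suc j))) → Adj G (f (inject₁ i)) (f (suc i)))
  × Adj G (f (fromℕ (suc (suc j)))) (f zero)

record IsTree {m} (G : Graph m) : Set where
  field
    nonempty  : 0 < m
    irrefl    : ∀ a → G a a ≡ false
    symmetric : ∀ a b → G a b ≡ G b a
    connected : ConnectedIn G full
    acyclic   : ¬ HasCycle G

Weight : ℕ → Set
Weight m = Fin m → ℕ

wt : ∀ {m} → Weight m → VSet m → ℕ
wt w U = sumFin (λ i → if U i then w i else 0)

wtAll : ∀ {m} → Weight m → ℕ
wtAll w = wt w full

degree : ∀ {m} → Graph m → Fin m → ℕ
degree G a = sumFin (λ b → if G a b then 1 else 0)

Leaf : ∀ {m} → Graph m → Fin m → Set
Leaf G a = degree G a ≡ 1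

record WeightedTree {m} (G : Graph m) (w : Weight m) : Set where
  field
    tree     : IsTree G
    positive : ∃[ v ] 0 < w v

record Canonical {m} (G : Graph m) (w : Weight m) : Set where
  field
    zeroIndep  : ∀ a b → Adj G a b → w a ≡ 0 → w b ≡ 0 → ⊥
    leafWeight : ∀ a → Leaf G a → 0 < w a

-- Subtrees of a vertex v: the components of T - v (vertex sets).

Comp : ∀ {m} → Graph m → Fin m → VSet m → Set
Comp G v C =
  v ∉ C
  × (∃[ a ] a ∈ C)
  × ConnectedIn G C
  × (∀ a b → a ∈ C → Adj G a b → b ≢ v → b ∈ C)

-- IsHs G w v h :  h = hs(v), the maximum weight of a subtree of v
-- (0 if there is no subtree, i.e. T has one vertex).
IsHs : ∀ {m} → Graph m → Weight m → Fin m → ℕ → Set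
IsHs G w v h =
  (∀ C → Comp G v C → wt w C ≤ h)
  × ((∃[ C ] (Comp G v C × wt w C ≡ h)) ⊎ ((∀ C → ¬ Comp G v C) × h ≡ 0))

Centroid : ∀ {m} → Graph m → Weight m → Fin m → Set
Centroid G w c = ∃[ h ] (IsHs G w c h × (∀ u h′ → IsHs G w u h′ → h ≤ h′))

Dist : ∀ {m} → Graph m → Fin m → Fin m → ℕ → Set
Dist G a b d = WalkIn G full a b d × (∀ k → WalkIn G full a b k → d ≤ k)

EccCent : ∀ {m} → Graph m → Weight m → Fin m → ℕ → Set
EccCent G w c e =
  (∀ x d → Centroid G w x → Dist G c x d → d ≤ e)
  × (∃[ x ] (Centroid G w x × Dist G c x e))

-- central centroid: a centroid which is a center of the path of centroids
Central : ∀ {m} → Graph m → Weight m → Fin m → Set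
Central G w c = Centroid G w c ×
  (∃[ e ] (EccCent G w c e × (∀ c′ e′ → Centroid G w c′ → EccCent G w c′ e′ → e ≤ e′)))

Case1 : ∀ {m} → Graph m → Weight m → Set
Case1 G w = ∃[ c ] (Centroid G w c × (∀ u → Centroid G w u → u ≡ c)
  × ∃[ h ] (IsHs G w c h × 2 * h < wtAll w))

ProperSubtree : ∀ {m} → Graph m → VSet m → VSet m → Set
ProperSubtree G T₁ S =
  (∀ x → x ∈ S → x ∈ T₁) × (∃[ x ] (x ∈ T₁ × x ∉ S))
  × (∃[ x ] x ∈ S) × ConnectedIn G S

EdgeSplit : ∀ {m} → Graph m → Fin m → Fin m → VSet m → VSet m → Set
EdgeSplit G c₁ c₂ T₁ T₂ =
  c₁ ∈ T₁ × c₂ ∈ T₂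
  × (∀ x → (x ∈ T₁ × x ∉ T₂) ⊎ (x ∉ T₁ × x ∈ T₂))
  × ConnectedIn G T₁ × ConnectedIn G T₂
  × (∀ a b → a ∈ T₁ → b ∈ T₂ → Adj G a b → (a ≡ c₁ × b ≡ c₂))

Case2 : ∀ {m} → Graph m → Weight m → Set
Case2 G w = ∃[ c₁ ] ∃[ c₂ ] (c₁ ≢ c₂
  × Centroid G w c₁ × Centroid G w c₂
  × (∀ u → Centroid G w u → u ≡ c₁ ⊎ u ≡ c₂)
  × Adj G c₁ c₂
  × ∃[ T₁ ] ∃[ T₂ ] (EdgeSplit G c₁ c₂ T₁ T₂
      × 2 * wt w T₁ ≡ wtAll w × 2 * wt w T₂ ≡ wtAll w
      × (∀ S → ProperSubtree G T₁ S → 2 * (wt w S + 1) ≤ wtAll w)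
      × (∀ S → ProperSubtree G T₂ S → 2 * (wt w S + 1) ≤ wtAll w)))

Case3 : ∀ {m} → Graph m → Weight m → Set
Case3 G w = ∃[ a ] ∃[ b ] ∃[ c ] (a ≢ b × a ≢ c × b ≢ c
  × Centroid G w a × Centroid G w b × Centroid G w c
  × (∀ u → Centroid G w u → u ≡ a ⊎ u ≡ b ⊎ u ≡ c)
  × Central G w c × (∀ u → Central G w u → u ≡ c)
  × w c ≡ 0
  × ∃[ C₁ ] ∃[ C₂ ] (Comp G c C₁ × Comp G c C₂
      × (∃[ x ] C₁ x ≢ C₂ x)
      × (∀ C → Comp G c C → (∀ x → C x ≡ C₁ x) ⊎ (∀ x → C x ≡ C₂ x))
      × 2 * wt w C₁ ≡ wtAll w × 2 * wt w C₂ ≡ wtAll w))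

ExactlyOne : Set → Set → Set → Set
ExactlyOne P Q R = (P ⊎ Q ⊎ R) × ¬ (P × Q) × ¬ (P × R) × ¬ (Q × R)

{-# OPTIONS --safe #-}

-- Removing an edge ab splits T into the branch of a and the branch of b, whose weights add up to n,
-- and hs(v) is the weight of the heaviest branch at v. Following heavy edges (branches of weight
-- above n/2) leads to a vertex x with 2 hs(x) ≤ n. If 2 hs(x) < n, every other vertex y sees the
-- branch containing x, of weight > hs(x), so x is the unique centroid. Otherwise the edge xu towards
-- its heaviest branch is balanced: both sides weigh h = n/2, every vertex has hs ≥ h, and the
-- centroids are the vertices with hs ≤ h. A third such vertex y, say on the side of u, forces
-- w(u) = 0 and y adjacent to u; the centroids are then x, u, y with u central (case 3). Without a
-- third one we are in case 2: by canonicity a vertex of weight 0 has at least two neighbours, all of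
-- positive weight, so every proper subtree of a side misses a vertex of positive weight.
module Submission where

open import Defs
open import Data.Nat using (ℕ; zero; suc; _+_; _*_; _≤_; _<_; z≤n; s≤s; _<?_; _≤?_)
open import Data.Nat.Properties
  using (≤-refl; ≤-trans; ≤-reflexive; ≤-antisym; ≤-pred; <-irrefl; <-≤-trans; <⇒≤; <⇒≱; ≮⇒≥; ≰⇒>;
         n≤0⇒n≡0; n≢0⇒n>0; m≤m+n; m≤n+m; +-comm; +-identityʳ; +-mono-≤; +-monoʳ-≤; +-monoˡ-≤; +-mono-<;
         +-cancelˡ-≤; +-cancelʳ-≤; +-cancelʳ-<; +-cancelʳ-≡; *-monoʳ-≤; *-distribˡ-+;
         +-commutativeSemigroup; anyUpTo?; module ≤-Reasoning)
  renaming (_≟_ to _≟ℕ_)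
open import Algebra.Properties.CommutativeSemigroup +-commutativeSemigroup using (interchange)
open import Data.Fin using (Fin; zero; suc; inject₁; fromℕ)
open import Data.Fin.Properties using (_≟_; any?; pigeonhole)
open import Data.Bool using (Bool; true; false; if_then_else_)
import Data.Bool.Properties as Bool
open import Data.Bool.Properties using (¬-not; ⇔→≡)
open import Data.List using (List; []; _∷_; length; lookup; allFin)
open import Data.List.Extrema.Nat using (argmax; f[xs]≤f[argmax]; f[argmax]≤v⁺)
open import Data.List.Relation.Unary.All.Properties using (tabulate⁺; tabulate⁻)
open import Data.List.Relation.Unary.Any using (here; there)
open import Data.List.Membership.Propositional using () renaming (_∈_ to _∈ₗ_; _∉_ to _∉ₗ_)
open import Data.List.Membership.Propositional.Properties using (∈-lookup)
open import Data.Product using (∃; ∃-syntax; _×_; _,_; proj₁; proj₂)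
open import Data.Sum using (_⊎_; inj₁; inj₂; swap)
open import Data.Empty using (⊥; ⊥-elim)
open import Relation.Nullary using (¬_; ¬?; Dec; yes; no; does; _×-dec_)
open import Relation.Nullary.Decidable using (dec-true)
open import Relation.Binary.PropositionalEquality
  using (_≡_; _≢_; _≗_; refl; sym; trans; cong; cong₂; subst)
open import Function.Bundles using (mk⇔)
open import Function.Definitions using (Injective)

double : ∀ h → 2 * h ≡ h + h
double h = cong (h +_) (+-identityʳ h)

≤half⇒half≤ : ∀ {A B h} → A + B ≡ 2 * h → A ≤ h → h ≤ B
≤half⇒half≤ {A} {B} {h} A+B≡2h A≤h = +-cancelˡ-≤ h h B (begin
  h + h  ≡⟨ sym (double h) ⟩
  2 * h  ≡⟨ sym A+B≡2h ⟩
  A + B  ≤⟨ +-monoˡ-≤ B A≤h ⟩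
  h + B  ∎)
  where open ≤-Reasoning

half≤⇒≤half : ∀ {A B h} → A + B ≡ 2 * h → h ≤ B → A ≤ h
half≤⇒≤half {A} {B} {h} A+B≡2h h≤B = +-cancelʳ-≤ B A h (begin
  A + B  ≡⟨ A+B≡2h ⟩
  2 * h  ≡⟨ double h ⟩
  h + h  ≤⟨ +-monoʳ-≤ h h≤B ⟩
  h + B  ∎)
  where open ≤-Reasoning

m+n≤m⇒n≡0 : ∀ m {n} → m + n ≤ m → n ≡ 0
m+n≤m⇒n≡0 m {n} m+n≤m = n≤0⇒n≡0 (+-cancelˡ-≤ m n 0 (subst (m + n ≤_) (sym (+-identityʳ m)) m+n≤m))

not-both-over-half : ∀ {A B n} → A + B ≡ n → n < 2 * A → n < 2 * B → ⊥
not-both-over-half {A} {B} {n} A+B≡n n<2A n<2B = <-irrefl refl (begin-strict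
  n + n          <⟨ +-mono-< n<2A n<2B ⟩
  2 * A + 2 * B  ≡⟨ sym (*-distribˡ-+ 2 A B) ⟩
  2 * (A + B)    ≡⟨ cong (2 *_) A+B≡n ⟩
  2 * n          ≡⟨ double n ⟩
  n + n          ∎)
  where open ≤-Reasoning

≤h⇒h<complement : ∀ {A B h n} → A + B ≡ n → B ≤ h → 2 * h < n → h < A
≤h⇒h<complement {A} {B} {h} {n} A+B≡n B≤h 2h<n = +-cancelʳ-< h h A (begin-strict
  h + h  ≡⟨ sym (double h) ⟩
  2 * h  <⟨ 2h<n ⟩
  n      ≡⟨ sym A+B≡n ⟩
  A + B  ≤⟨ +-monoʳ-≤ A B≤h ⟩
  A + h  ∎)
  where open ≤-Reasoning

complement-of-half : ∀ {A B h} → A + B ≡ 2 * h → B ≡ h → A ≡ h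
complement-of-half {A} {h = h} A+B≡2h refl = +-cancelʳ-≡ h A h (trans A+B≡2h (double h))

over-half⇒positive : ∀ {n h} → n < 2 * h → 0 < h
over-half⇒positive {h = suc h} _ = s≤s z≤n

sumFin-mono : ∀ {m} {f g : Fin m → ℕ} → (∀ i → f i ≤ g i) → sumFin f ≤ sumFin g
sumFin-mono {zero}  f≤g = z≤n
sumFin-mono {suc m} f≤g = +-mono-≤ (f≤g zero) (sumFin-mono (λ i → f≤g (suc i)))

sumFin-+ : ∀ {m} (f g : Fin m → ℕ) → sumFin (λ i → f i + g i) ≡ sumFin f + sumFin g
sumFin-+ {zero}  f g = refl
sumFin-+ {suc m} f g = trans (cong (f zero + g zero +_) (sumFin-+ (λ i → f (suc i)) (λ i → g (suc i))))
                             (interchange (f zero) (g zero) _ _)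

sumFin-cong : ∀ {m} {f g : Fin m → ℕ} → f ≗ g → sumFin f ≡ sumFin g
sumFin-cong {zero}  f≗g = refl
sumFin-cong {suc m} f≗g = cong₂ _+_ (f≗g zero) (sumFin-cong (λ i → f≗g (suc i)))

sumFin-zero : ∀ {m} (f : Fin m → ℕ) → (∀ i → f i ≡ 0) → sumFin f ≡ 0
sumFin-zero {zero}  f f≡0 = refl
sumFin-zero {suc m} f f≡0 rewrite f≡0 zero = sumFin-zero (λ i → f (suc i)) (λ i → f≡0 (suc i))

∉⇒¬∈ : ∀ {b : Bool} → b ≡ false → ¬ b ≡ true
∉⇒¬∈ refl ()

singleton : ∀ {m} → Fin m → VSet m
singleton x y = does (y ≟ x)

∈-singleton : ∀ {m} {x y : Fin m} → y ∈ singleton x → y ≡ x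
∈-singleton {x = x} {y} y∈ with y ≟ x
... | yes y≡x = y≡x

sumFin-singleton : ∀ {m} (x : Fin m) (f : Fin m → ℕ) →
  sumFin (λ i → if singleton x i then f i else 0) ≡ f x
sumFin-singleton {suc m} zero    f =
  trans (cong (f zero +_) (sumFin-zero {m} _ (λ _ → refl))) (+-identityʳ _)
sumFin-singleton {suc m} (suc x) f = sumFin-singleton x (λ i → f (suc i))

_⊆_ : ∀ {m} → VSet m → VSet m → Set
U ⊆ V = ∀ i → i ∈ U → i ∈ V

Disjoint : ∀ {m} → VSet m → VSet m → Set
Disjoint U V = ∀ i → i ∈ U → i ∈ V → ⊥

module Weights {m} (w : Weight m) where

  private
    weightIn : VSet m → Fin m → ℕ
    weightIn U i = if U i then w i else 0

    sum-weightIn : ∀ U V → wt w U + wt w V ≡ sumFin (λ i → weightIn U i + weightIn V i)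
    sum-weightIn U V = sym (sumFin-+ (weightIn U) (weightIn V))

  wt-cong : ∀ {U V} → U ≗ V → wt w U ≡ wt w V
  wt-cong U≗V = sumFin-cong (λ i → cong (λ b → if b then w i else 0) (U≗V i))

  wt-mono : ∀ {U V} → U ⊆ V → wt w U ≤ wt w V
  wt-mono {U} {V} U⊆V = sumFin-mono pointwise
    where
    pointwise : ∀ i → weightIn U i ≤ weightIn V i
    pointwise i with U i in Ui
    ... | false = z≤n
    ... | true rewrite U⊆V i Ui = ≤-refl

  wt-∅ : ∀ {U} → (∀ i → ¬ i ∈ U) → wt w U ≡ 0
  wt-∅ {U} empty = sumFin-zero (weightIn U) pointwise
    where
    pointwise : ∀ i → weightIn U i ≡ 0
    pointwise i with U i in Ui
    ... | false = refl
    ... | true  = ⊥-elim (empty i Ui)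

  wt-singleton : ∀ x → wt w (singleton x) ≡ w x
  wt-singleton x = sumFin-singleton x w

  wt-disjoint : ∀ {U V Z} → Disjoint U V → U ⊆ Z → V ⊆ Z → wt w U + wt w V ≤ wt w Z
  wt-disjoint {U} {V} {Z} U∩V U⊆Z V⊆Z = subst (_≤ wt w Z) (sym (sum-weightIn U V)) (sumFin-mono pointwise)
    where
    pointwise : ∀ i → weightIn U i + weightIn V i ≤ weightIn Z i
    pointwise i with U i in Ui | V i in Vi
    ... | true  | true  = ⊥-elim (U∩V i Ui Vi)
    ... | true  | false rewrite U⊆Z i Ui = ≤-reflexive (+-identityʳ (w i))
    ... | false | true  rewrite V⊆Z i Vi = ≤-refl
    ... | false | false = z≤n

  wt-cover : ∀ {U V Z} → (∀ i → i ∈ U → i ∈ V ⊎ i ∈ Z) → wt w U ≤ wt w V + wt w Z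
  wt-cover {U} {V} {Z} cover = subst (wt w U ≤_) (sym (sum-weightIn V Z)) (sumFin-mono pointwise)
    where
    pointwise : ∀ i → weightIn U i ≤ weightIn V i + weightIn Z i
    pointwise i with U i in Ui | V i in Vi | Z i in Zi
    ... | false | _     | _     = z≤n
    ... | true  | true  | _     = m≤m+n (w i) _
    ... | true  | false | true  = m≤n+m (w i) 0
    ... | true  | false | false with cover i Ui
    ...   | inj₁ i∈V = ⊥-elim (∉⇒¬∈ Vi i∈V)
    ...   | inj₂ i∈Z = ⊥-elim (∉⇒¬∈ Zi i∈Z)

  wt-insert : ∀ {U V z} → z ∉ U → U ⊆ V → z ∈ V → wt w U + w z ≤ wt w V
  wt-insert {U} {V} {z} z∉U U⊆V z∈V =
    subst (λ k → wt w U + k ≤ wt w V) (wt-singleton z)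
      (wt-disjoint (λ i i∈U i∈z → ∉⇒¬∈ z∉U (subst (_∈ U) (∈-singleton i∈z) i∈U)) U⊆V
                   (λ i i∈z → subst (_∈ V) (sym (∈-singleton i∈z)) z∈V))

  w≤wt : ∀ {U x} → x ∈ U → w x ≤ wt w U
  w≤wt {U} {x} x∈U =
    subst (_≤ wt w U) (wt-singleton x) (wt-mono (λ i i∈x → subst (_∈ U) (sym (∈-singleton i∈x)) x∈U))

module Walks {m} (G : Graph m) where

  open import Data.List.Membership.DecPropositional (_≟_ {m}) using (_∈?_)

  Reach : VSet m → Fin m → Fin m → Set
  Reach X a b = ∃[ k ] WalkIn G X a b k

  _∖_ : VSet m → Fin m → VSet m
  (X ∖ c) y = if does (y ≟ c) then false else X y

  ∖-≢ : ∀ {X c y} → y ∈ (X ∖ c) → y ≢ c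
  ∖-≢ {c = c} {y} y∈ with y ≟ c
  ... | no y≢c = y≢c

  ∖-intro : ∀ {X c y} → y ∈ X → y ≢ c → y ∈ (X ∖ c)
  ∖-intro {c = c} {y} y∈ y≢c with y ≟ c
  ... | yes y≡c = ⊥-elim (y≢c y≡c)
  ... | no _    = y∈

  walk-source : ∀ {X a b k} → WalkIn G X a b k → a ∈ X
  walk-source (here a∈)     = a∈
  walk-source (step a∈ _ _) = a∈

  walk-target : ∀ {X a b k} → WalkIn G X a b k → b ∈ X
  walk-target (here b∈)    = b∈
  walk-target (step _ _ W) = walk-target W

  walk-mono : ∀ {X Y a b k} → X ⊆ Y → WalkIn G X a b k → WalkIn G Y a b k
  walk-mono X⊆Y (here a∈)     = here (X⊆Y _ a∈)
  walk-mono X⊆Y (step a∈ e W) = step (X⊆Y _ a∈) e (walk-mono X⊆Y W)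

  walk-++ : ∀ {X a b c k l} → WalkIn G X a b k → WalkIn G X b c l → WalkIn G X a c (k + l)
  walk-++ (here _)      V = V
  walk-++ (step a∈ e W) V = step a∈ e (walk-++ W V)

  reach-source : ∀ {X a b} → Reach X a b → a ∈ X
  reach-source (_ , W) = walk-source W

  reach-target : ∀ {X a b} → Reach X a b → b ∈ X
  reach-target (_ , W) = walk-target W

  reach-mono : ∀ {X Y a b} → X ⊆ Y → Reach X a b → Reach Y a b
  reach-mono X⊆Y (k , W) = k , walk-mono X⊆Y W

  reach-refl : ∀ {X a} → a ∈ X → Reach X a a
  reach-refl a∈ = 0 , here a∈

  reach-edge : ∀ {X a b} → a ∈ X → b ∈ X → Adj G a b → Reach X a b
  reach-edge a∈ b∈ e = 1 , step a∈ e (here b∈)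

  reach-trans : ∀ {X a b c} → Reach X a b → Reach X b c → Reach X a c
  reach-trans (k , W) (l , V) = k + l , walk-++ W V

  first-entry : ∀ {X t c k} → WalkIn G X t c k → t ≢ c →
    ∃[ p ] (Adj G p c × p ∈ X × Reach (X ∖ c) t p)
  first-entry (here _) t≢c = ⊥-elim (t≢c refl)
  first-entry {X} {t} {c} (step {c = s} t∈ e W) t≢c with s ≟ c
  ... | yes refl = t , e , t∈ , reach-refl (∖-intro {X} t∈ t≢c)
  ... | no s≢c with first-entry W s≢c
  ...   | p , pc , p∈ , s↝p = p , pc , p∈ , reach-trans t↝s s↝p
    where
    t↝s : Reach (X ∖ c) t s
    t↝s = reach-edge (∖-intro {X} t∈ t≢c) (∖-intro {X} (walk-source W) s≢c) e

  avoids-or-passes : ∀ {X y c k} z → WalkIn G X y c k → Reach (X ∖ z) y c ⊎ Reach X z c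
  avoids-or-passes {X} {y} z (here y∈) with y ≟ z
  ... | yes refl = inj₂ (reach-refl y∈)
  ... | no y≢z   = inj₁ (reach-refl (∖-intro {X} y∈ y≢z))
  avoids-or-passes {X} {y} z (step y∈ e W) with avoids-or-passes z W
  ... | inj₂ z↝c = inj₂ z↝c
  ... | inj₁ s↝c with y ≟ z
  ...   | yes refl = inj₂ (_ , step y∈ e W)
  ...   | no y≢z   = inj₁ (reach-trans (reach-edge (∖-intro {X} y∈ y≢z) (reach-source s↝c) e) s↝c)

  -- The vertices of the path are a ∷ vs, all distinct.
  data Path (X : VSet m) : Fin m → Fin m → List (Fin m) → Set where
    end  : ∀ {a} → a ∈ X → Path X a a []
    cons : ∀ {a c b vs} → a ∈ X → Adj G a c → Path X c b vs → a ∉ₗ (c ∷ vs) → Path X a b (c ∷ vs)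

  path-vertices : ∀ {X a b vs x} → Path X a b vs → x ∈ₗ (a ∷ vs) → x ∈ X
  path-vertices (end a∈)        (here refl) = a∈
  path-vertices (cons a∈ _ _ _) (here refl) = a∈
  path-vertices (cons _ _ P _)  (there x∈)  = path-vertices P x∈

  path-mono : ∀ {X Y a b vs} → X ⊆ Y → Path X a b vs → Path Y a b vs
  path-mono X⊆Y (end a∈)          = end (X⊆Y _ a∈)
  path-mono X⊆Y (cons a∈ e P a∉) = cons (X⊆Y _ a∈) e (path-mono X⊆Y P) a∉

  path-suffix : ∀ {X a b vs x} → Path X a b vs → x ∈ₗ (a ∷ vs) → ∃ (Path X x b)
  path-suffix P              (here refl) = _ , P
  path-suffix (cons _ _ P _) (there x∈)  = path-suffix P x∈

  walk⇒path : ∀ {X a b k} → WalkIn G X a b k → ∃ (Path X a b)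
  walk⇒path (here a∈) = [] , end a∈
  walk⇒path {a = a} (step {c = c} a∈ e W) with walk⇒path W
  ... | vs , P with a ∈? (c ∷ vs)
  ...   | yes a∈vs = path-suffix P a∈vs
  ...   | no a∉vs  = c ∷ vs , cons a∈ e P a∉vs

  path⇒walk : ∀ {X a b vs} → Path X a b vs → WalkIn G X a b (length vs)
  path⇒walk (end a∈)        = here a∈
  path⇒walk (cons a∈ e P _) = step a∈ e (path⇒walk P)

  path-injective : ∀ {X a b vs} → Path X a b vs → Injective _≡_ _≡_ (lookup (a ∷ vs))
  path-injective P              {zero}  {zero}  _   = refl
  path-injective (cons _ _ P a∉) {zero}  {suc j} a≡  = ⊥-elim (a∉ (subst (_∈ₗ _) (sym a≡) (∈-lookup j)))
  path-injective (cons _ _ P a∉) {suc i} {zero}  ≡a  = ⊥-elim (a∉ (subst (_∈ₗ _) ≡a (∈-lookup i)))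
  path-injective (cons _ _ P _)  {suc i} {suc j} eq = cong suc (path-injective P eq)

  path-adjacent : ∀ {X a b vs} → Path X a b vs → ∀ (i : Fin (length vs)) →
    Adj G (lookup (a ∷ vs) (inject₁ i)) (lookup (a ∷ vs) (suc i))
  path-adjacent (cons _ e _ _) zero    = e
  path-adjacent (cons _ _ P _) (suc i) = path-adjacent P i

  path-last : ∀ {X a b vs} → Path X a b vs → lookup (a ∷ vs) (fromℕ (length vs)) ≡ b
  path-last (end _)        = refl
  path-last (cons _ _ P _) = path-last P

  path-length< : ∀ {X a b vs} → Path X a b vs → length vs < m
  path-length< {vs = vs} P with length vs <? m
  ... | yes short = short
  ... | no long with pigeonhole (≰⇒> long) (lookup (_ ∷ vs))
  ...   | i , j , i<j , same with path-injective P {i} {j} same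
  ...     | refl = ⊥-elim (<-irrefl refl i<j)

  path-cycle : ∀ {X a b c d vs} → Path X a b (c ∷ d ∷ vs) → Adj G b a → HasCycle G
  path-cycle {a = a} {c = c} {d} {vs} P ba =
    length vs , lookup (a ∷ c ∷ d ∷ vs) , path-injective P , path-adjacent P ,
    subst (λ x → Adj G x a) (sym (path-last P)) ba

  adj? : ∀ a b → Dec (Adj G a b)
  adj? a b = G a b Bool.≟ true

  walk? : ∀ X k a b → Dec (WalkIn G X a b k)
  walk? X zero a b with a ≟ b | X a in Xa
  ... | yes refl | true  = yes (here Xa)
  ... | yes refl | false = no λ { (here a∈) → ∉⇒¬∈ Xa a∈ }
  ... | no a≢b   | _     = no λ { (here _) → a≢b refl }
  walk? X (suc k) a b with X a in Xa | any? (λ c → adj? a c ×-dec walk? X k c b)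
  ... | false | _                = no λ { (step a∈ _ _) → ∉⇒¬∈ Xa a∈ }
  ... | true  | yes (c , e , W)  = yes (step Xa e W)
  ... | true  | no ∄             = no λ { (step _ e W) → ∄ (_ , e , W) }

  -- A reachable vertex is reachable by a simple path, hence by a walk of length below m.
  reach? : ∀ X a b → Dec (Reach X a b)
  reach? X a b with anyUpTo? (λ k → walk? X k a b) m
  ... | yes (k , _ , W) = yes (k , W)
  ... | no ∄ = no λ (_ , W) → let (vs , P) = walk⇒path W in ∄ (length vs , path-length< P , path⇒walk P)

module Tree {m} (G : Graph m) (T : IsTree G) where

  open IsTree T
  open Walks G public

  adj-sym : ∀ {a b} → Adj G a b → Adj G b a
  adj-sym {a} {b} ab = trans (symmetric b a) ab

  adj-irrefl : ∀ {a b} → Adj G a b → a ≢ b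
  adj-irrefl {a} aa refl = ∉⇒¬∈ (irrefl a) aa

  reach-reverse : ∀ {X a b} → Reach X a b → Reach X b a
  reach-reverse (_ , here a∈)     = reach-refl a∈
  reach-reverse (_ , step a∈ e W) =
    reach-trans (reach-reverse (_ , W)) (reach-edge (walk-source W) a∈ (adj-sym e))

  T∖ : Fin m → VSet m
  T∖ v = full ∖ v

  T∖-intro : ∀ {v t} → t ≢ v → t ∈ T∖ v
  T∖-intro = ∖-intro {full} refl

  T∖-≢ : ∀ {v t} → t ∈ T∖ v → t ≢ v
  T∖-≢ = ∖-≢ {full}

  ∖-⊆-T∖ : ∀ {X v} → (X ∖ v) ⊆ (T∖ v)
  ∖-⊆-T∖ {X} _ t∈ = T∖-intro (∖-≢ {X} t∈)

  -- branch v a is the subtree of v containing a; it is empty when a = v.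
  opaque
    branch : Fin m → Fin m → VSet m
    branch v a t = does (reach? (T∖ v) a t)

    branch-intro : ∀ {v a t} → Reach (T∖ v) a t → t ∈ branch v a
    branch-intro {v} {a} {t} = dec-true (reach? (T∖ v) a t)

    branch-elim : ∀ {v a t} → t ∈ branch v a → Reach (T∖ v) a t
    branch-elim {v} {a} {t} t∈ with reach? (T∖ v) a t
    ... | yes a↝t = a↝t

  ∈branch⇒≢ : ∀ {v a t} → t ∈ branch v a → t ≢ v
  ∈branch⇒≢ t∈ = T∖-≢ (reach-target (branch-elim t∈))

  nonempty-branch⇒≢ : ∀ {v a t} → t ∈ branch v a → a ≢ v
  nonempty-branch⇒≢ t∈ = T∖-≢ (reach-source (branch-elim t∈))

  branch-∋ : ∀ {v a} → a ≢ v → a ∈ branch v a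
  branch-∋ a≢v = branch-intro (reach-refl (T∖-intro a≢v))

  branch-closed : ∀ {v a s t} → s ∈ branch v a → Adj G s t → t ≢ v → t ∈ branch v a
  branch-closed s∈ st t≢v = branch-intro
    (reach-trans (branch-elim s∈) (reach-edge (reach-target (branch-elim s∈)) (T∖-intro t≢v) st))

  ∈branch⇒same-branch : ∀ {v a s} → s ∈ branch v a → branch v s ≗ branch v a
  ∈branch⇒same-branch s∈ t = ⇔→≡ (mk⇔
    (λ t∈ → branch-intro (reach-trans (branch-elim s∈) (branch-elim t∈)))
    (λ t∈ → branch-intro (reach-trans (reach-reverse (branch-elim s∈)) (branch-elim t∈))))

  branches-disjoint : ∀ {v a b} → ¬ a ∈ branch v b → Disjoint (branch v a) (branch v b)
  branches-disjoint {v} {a} a∉ t t∈a t∈b =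
    a∉ (trans (sym (∈branch⇒same-branch t∈b a))
              (trans (∈branch⇒same-branch t∈a a) (branch-∋ (nonempty-branch⇒≢ t∈a))))

  neighbour-towards : ∀ {v t} → t ≢ v → ∃[ u ] (Adj G v u × t ∈ branch v u)
  neighbour-towards {v} {t} t≢v with first-entry (proj₂ (connected t v refl refl)) t≢v
  ... | u , uv , _ , t↝u = u , adj-sym uv , branch-intro (reach-reverse t↝u)

  private
    walk-in-branch : ∀ {v a s x k} → s ∈ branch v a → WalkIn G (T∖ v) s x k → WalkIn G (branch v a) s x k
    walk-in-branch s∈ (here _)     = here s∈
    walk-in-branch s∈ (step _ e W) =
      step s∈ e (walk-in-branch (branch-closed s∈ e (T∖-≢ (walk-source W))) W)

  branch-connected : ∀ {v a} → ConnectedIn G (branch v a)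
  branch-connected x y x∈ y∈ =
    let (k , W) = reach-trans (reach-reverse (branch-elim x∈)) (branch-elim y∈) in k , walk-in-branch x∈ W

  branch-comp : ∀ {v a} → a ≢ v → Comp G v (branch v a)
  branch-comp a≢v =
    ¬-not (λ v∈ → ∈branch⇒≢ v∈ refl) , (_ , branch-∋ a≢v) , branch-connected ,
    (λ s t s∈ st t≢v → branch-closed s∈ st t≢v)

  comp≗branch : ∀ {v C a} → Comp G v C → a ∈ C → C ≗ branch v a
  comp≗branch {v} {C} {a} (v∉C , _ , C-connected , C-closed) a∈ t = ⇔→≡ (mk⇔
    (λ t∈ → branch-intro (reach-mono C⊆T∖v (C-connected a t a∈ t∈)))
    (λ t∈ → walk-closed a∈ (proj₂ (branch-elim t∈))))
    where
    C⊆T∖v : C ⊆ (T∖ v)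
    C⊆T∖v s s∈ = T∖-intro {v} {s} λ { refl → ∉⇒¬∈ v∉C s∈ }
    walk-closed : ∀ {s x k} → s ∈ C → WalkIn G (T∖ v) s x k → x ∈ C
    walk-closed s∈ (here _)     = s∈
    walk-closed s∈ (step _ e W) = walk-closed (C-closed _ _ s∈ e (T∖-≢ (walk-source W))) W

  comp≗neighbour-branch : ∀ {v C} → Comp G v C → ∃[ u ] (Adj G v u × C ≗ branch v u)
  comp≗neighbour-branch {C = C} cp@(v∉C , (a , a∈) , _) with neighbour-towards (λ { refl → ∉⇒¬∈ v∉C a∈ })
  ... | u , vu , a∈u = u , vu , λ t → trans (comp≗branch cp a∈ t) (∈branch⇒same-branch a∈u t)

  branch-neighbour-unique : ∀ {a b p} → Adj G a b → p ∈ branch a b → Adj G p a → p ≡ b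
  branch-neighbour-unique {a} {b} ab p∈ pa with walk⇒path (proj₂ (branch-elim p∈))
  ... | []    , end _ = refl
  ... | _ ∷ _ , P     = ⊥-elim (acyclic (path-cycle (cons refl ab (path-mono (λ _ _ → refl) P) a∉P) pa))
    where
    a∉P : a ∉ₗ (b ∷ _)
    a∉P a∈ = T∖-≢ {a} (path-vertices P a∈) refl

  edge-sides-disjoint : ∀ {a b} → Adj G a b → Disjoint (branch b a) (branch a b)
  edge-sides-disjoint {a} {b} ab t t∈ba t∈ab
    with first-entry (proj₂ (reach-reverse (branch-elim t∈ba))) (∈branch⇒≢ t∈ab)
  ... | p , pa , p∈ , t↝p = T∖-≢ p∈ (branch-neighbour-unique ab p∈a-side pa)
    where
    p∈a-side : p ∈ branch a b
    p∈a-side = branch-intro (reach-trans (branch-elim t∈ab) (reach-mono ∖-⊆-T∖ t↝p))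

  edge-sides-cover : ∀ {a b} → Adj G a b → ∀ t → t ∈ branch b a ⊎ t ∈ branch a b
  edge-sides-cover {a} {b} ab t with t ≟ b
  ... | yes refl = inj₂ (branch-∋ (adj-irrefl (adj-sym ab)))
  ... | no t≢b with first-entry (proj₂ (connected t b refl refl)) t≢b
  ...   | p , pb , _ , t↝p with p ≟ a
  ...     | yes refl = inj₁ (branch-intro (reach-reverse t↝p))
  ...     | no p≢a with avoids-or-passes a (proj₂ (reach-reverse t↝p))
  ...       | inj₂ a↝t = inj₁ (branch-intro a↝t)
  ...       | inj₁ p↝t = inj₂ (branch-intro (reach-trans
                 (reach-edge (T∖-intro (adj-irrefl (adj-sym ab))) (T∖-intro p≢a) (adj-sym pb))
                 (reach-mono ∖-⊆-T∖ p↝t)))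

  branch-nested : ∀ {a b t} → Adj G a b → t ∈ branch a b → branch b t ⊆ branch a b
  branch-nested {a} ab t∈ y y∈ with avoids-or-passes a (proj₂ (reach-reverse (branch-elim y∈)))
  ... | inj₁ y↝t = branch-intro (reach-trans (branch-elim t∈) (reach-reverse (reach-mono ∖-⊆-T∖ y↝t)))
  ... | inj₂ a↝t = ⊥-elim (edge-sides-disjoint ab _ (branch-intro a↝t) t∈)

  opposite-side⊆branch : ∀ {a b z} → Adj G a b → z ∈ branch a b → branch b a ⊆ branch z a
  opposite-side⊆branch {a} {b} {z} ab z∈ y y∈
    with avoids-or-passes z (proj₂ (reach-reverse (branch-elim y∈)))
  ... | inj₁ y↝a = branch-intro (reach-reverse (reach-mono ∖-⊆-T∖ y↝a))
  ... | inj₂ z↝a = ⊥-elim (edge-sides-disjoint ab _ (branch-intro (reach-reverse z↝a)) z∈)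

  dist-adjacent : ∀ {a b} → Adj G a b → Dist G a b 1
  dist-adjacent ab = step refl ab (here refl) , shortest
    where
    shortest : ∀ k → WalkIn G full _ _ k → 1 ≤ k
    shortest zero    (here _) = ⊥-elim (adj-irrefl ab refl)
    shortest (suc k) _        = s≤s z≤n

  dist-two : ∀ {a b c} → Adj G a b → Adj G b c → a ≢ c → ¬ Adj G a c → Dist G a c 2
  dist-two ab bc a≢c ¬ac = step refl ab (step refl bc (here refl)) , shortest
    where
    shortest : ∀ k → WalkIn G full _ _ k → 2 ≤ k
    shortest zero          (here _)              = ⊥-elim (a≢c refl)
    shortest (suc zero)    (step _ ac (here _)) = ⊥-elim (¬ac ac)
    shortest (suc (suc k)) _                    = s≤s (s≤s z≤n)

  connected-set-single-neighbour : ∀ {S x y₁ y₂} → ConnectedIn G S → x ∉ S → y₁ ∈ S → y₂ ∈ S →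
    Adj G x y₁ → Adj G x y₂ → y₁ ≡ y₂
  connected-set-single-neighbour {S} {x} S-connected x∉S y₁∈ y₂∈ xy₁ xy₂ =
    sym (branch-neighbour-unique xy₁ (branch-intro (reach-mono S⊆T∖x (S-connected _ _ y₁∈ y₂∈)))
                                 (adj-sym xy₂))
    where
    S⊆T∖x : S ⊆ (T∖ x)
    S⊆T∖x s s∈ = T∖-intro {x} {s} λ { refl → ∉⇒¬∈ x∉S s∈ }

module WeightedTrees {m} (G : Graph m) (w : Weight m) (T : IsTree G) where

  open Tree G T public
  open Weights w public
  private
    module Card = Weights {m} (λ _ → 1)

    card : VSet m → ℕ
    card = wt {m} (λ _ → 1)

  n : ℕ
  n = wtAll w

  edge-sides-weight : ∀ {a b} → Adj G a b → wt w (branch b a) + wt w (branch a b) ≡ n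
  edge-sides-weight ab = ≤-antisym
    (wt-disjoint (edge-sides-disjoint ab) (λ _ _ → refl) (λ _ _ → refl))
    (wt-cover (λ t _ → edge-sides-cover ab t))

  opaque
    heaviest : Fin m → Fin m
    heaviest v = argmax (λ a → wt w (branch v a)) v (allFin m)

  hs : Fin m → ℕ
  hs v = wt w (branch v (heaviest v))

  opaque
    unfolding heaviest

    branch≤hs : ∀ v a → wt w (branch v a) ≤ hs v
    branch≤hs v = tabulate⁻ (f[xs]≤f[argmax] v (allFin m))

    hs≤ : ∀ {v B} → (∀ a → wt w (branch v a) ≤ B) → hs v ≤ B
    hs≤ {v} bound = f[argmax]≤v⁺ {f = λ a → wt w (branch v a)} (bound v) (tabulate⁺ bound)

  heaviest≡self⇒hs≡0 : ∀ {v} → heaviest v ≡ v → hs v ≡ 0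
  heaviest≡self⇒hs≡0 {v} h≡v = wt-∅ (λ t t∈ → nonempty-branch⇒≢ t∈ h≡v)

  hs-attained-at-neighbour : ∀ {v} → 0 < hs v → ∃[ u ] (Adj G v u × hs v ≡ wt w (branch v u))
  hs-attained-at-neighbour {v} 0<hs with heaviest v ≟ v
  ... | yes h≡v = ⊥-elim (<-irrefl (sym (heaviest≡self⇒hs≡0 h≡v)) 0<hs)
  ... | no h≢v with comp≗neighbour-branch (branch-comp h≢v)
  ...   | u , vu , same = u , vu , wt-cong same

  comp≤hs : ∀ {v C} → Comp G v C → wt w C ≤ hs v
  comp≤hs {v} cp@(_ , (a , a∈) , _) = subst (_≤ hs v) (sym (wt-cong (comp≗branch cp a∈))) (branch≤hs v a)

  hs-isHs : ∀ v → IsHs G w v (hs v)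
  hs-isHs v = (λ _ → comp≤hs) , attained
    where
    attained : (∃[ C ] (Comp G v C × wt w C ≡ hs v)) ⊎ ((∀ C → ¬ Comp G v C) × hs v ≡ 0)
    attained with heaviest v ≟ v
    ... | no h≢v = inj₁ (_ , branch-comp h≢v , refl)
    ... | yes h≡v with any? (λ b → ¬? (b ≟ v))
    ...   | yes (b , b≢v) = inj₁ (_ , branch-comp b≢v ,
              trans (n≤0⇒n≡0 (subst (wt w (branch v b) ≤_) (heaviest≡self⇒hs≡0 h≡v) (branch≤hs v b)))
                    (sym (heaviest≡self⇒hs≡0 h≡v)))
    ...   | no ∄ = inj₂ ((λ { C (v∉C , (a , a∈) , _) → ∄ (a , λ { refl → ∉⇒¬∈ v∉C a∈ }) }) ,
                         heaviest≡self⇒hs≡0 h≡v)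

  isHs≤ : ∀ {v h h′} → IsHs G w v h → IsHs G w v h′ → h ≤ h′
  isHs≤ (_ , inj₁ (C , cp , refl)) (bound , _) = bound C cp
  isHs≤ (_ , inj₂ (_ , refl))      _           = z≤n

  isHs⇒≡hs : ∀ {v h} → IsHs G w v h → h ≡ hs v
  isHs⇒≡hs {v} isHs = ≤-antisym (isHs≤ isHs (hs-isHs v)) (isHs≤ (hs-isHs v) isHs)

  centroid⇒hs-minimal : ∀ {c} → Centroid G w c → ∀ y → hs c ≤ hs y
  centroid⇒hs-minimal (h , isHs , minimal) y =
    subst (_≤ hs y) (isHs⇒≡hs isHs) (minimal y (hs y) (hs-isHs y))

  hs-minimal⇒centroid : ∀ {c} → (∀ y → hs c ≤ hs y) → Centroid G w c
  hs-minimal⇒centroid {c} minimal =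
    hs c , hs-isHs c , λ y h′ isHs → subst (hs c ≤_) (sym (isHs⇒≡hs isHs)) (minimal y)

  hs≤-via-edge : ∀ {a b B} → Adj G a b → wt w (branch b a) ≤ B → wt w (branch a b) ≤ B → hs b ≤ B
  hs≤-via-edge {a} {b} {B} ab ba≤B ab≤B = hs≤ bound
    where
    bound : ∀ t → wt w (branch b t) ≤ B
    bound t with edge-sides-cover ab t
    ... | inj₁ t∈ba = subst (_≤ B) (sym (wt-cong (∈branch⇒same-branch t∈ba))) ba≤B
    ... | inj₂ t∈ab = ≤-trans (wt-mono (branch-nested ab t∈ab)) ab≤B

  opposite-side≤hs : ∀ {a b y} → Adj G a b → y ∈ branch a b → wt w (branch b a) ≤ hs y
  opposite-side≤hs {a} {y = y} ab y∈ = ≤-trans (wt-mono (opposite-side⊆branch ab y∈)) (branch≤hs y a)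

  private
    heavy-step : ∀ {v u} → Adj G v u → n < 2 * wt w (branch v u) → n < 2 * hs u →
      ∃[ z ] (Adj G u z × n < 2 * wt w (branch u z) × card (branch u z) < card (branch v u))
    heavy-step {v} {u} vu heavy-vu heavy-u with hs-attained-at-neighbour (over-half⇒positive heavy-u)
    ... | z , uz , hs≡ = z , uz , subst (λ k → n < 2 * k) hs≡ heavy-u , smaller
      where
      u≢v : u ≢ v
      u≢v refl = adj-irrefl vu refl
      z≢v : z ≢ v
      z≢v refl = not-both-over-half {wt w (branch u v)} {wt w (branch v u)}
                   (edge-sides-weight vu) (subst (λ k → n < 2 * k) hs≡ heavy-u) heavy-vu
      smaller : card (branch u z) < card (branch v u)
      smaller = subst (_≤ card (branch v u)) (+-comm _ 1)
        (Card.wt-insert {branch u z} {branch v u} {u} (¬-not (λ u∈ → ∈branch⇒≢ u∈ refl))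
                        (branch-nested vu (branch-closed (branch-∋ u≢v) uz z≢v))
                        (branch-∋ u≢v))

    descend : ∀ N {v u} → Adj G v u → n < 2 * wt w (branch v u) → card (branch v u) < N →
      ∃[ x ] (2 * hs x ≤ n)
    descend (suc N) {u = u} vu heavy-vu size<N with 2 * hs u ≤? n
    ... | yes light = u , light
    ... | no heavy with heavy-step vu heavy-vu (≰⇒> heavy)
    ...   | z , uz , heavy-uz , smaller = descend N uz heavy-uz (<-≤-trans smaller (≤-pred size<N))

  light-vertex : Fin m → ∃[ x ] (2 * hs x ≤ n)
  light-vertex v with 2 * hs v ≤? n
  ... | yes light = v , light
  ... | no heavy with hs-attained-at-neighbour (over-half⇒positive (≰⇒> heavy))
  ...   | u , vu , hs≡ = descend _ vu (subst (λ k → n < 2 * k) hs≡ (≰⇒> heavy)) ≤-refl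

  balanced-heaviest-edge : ∀ {x} → 0 < n → 2 * hs x ≡ n →
    ∃[ u ] (Adj G x u × wt w (branch u x) ≡ hs x × wt w (branch x u) ≡ hs x)
  balanced-heaviest-edge {x} 0<n 2h≡n
    with hs-attained-at-neighbour (over-half⇒positive (subst (0 <_) (sym 2h≡n) 0<n))
  ... | u , xu , hs≡ =
    u , xu , complement-of-half (trans (edge-sides-weight xu) (sym 2h≡n)) (sym hs≡) , sym hs≡

  strictly-light⇒case1 : ∀ {c} → 2 * hs c < n → Case1 G w
  strictly-light⇒case1 {c} strict = c , hs-minimal⇒centroid minimal , unique , hs c , hs-isHs c , strict
    where
    others-heavier : ∀ {y} → y ≢ c → hs c < hs y
    others-heavier y≢c with neighbour-towards y≢c
    ... | u , cu , y∈ = <-≤-trans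
      (≤h⇒h<complement (edge-sides-weight cu) (branch≤hs c u) strict)
      (opposite-side≤hs cu y∈)
    minimal : ∀ y → hs c ≤ hs y
    minimal y with y ≟ c
    ... | yes refl = ≤-refl
    ... | no y≢c   = <⇒≤ (others-heavier y≢c)
    unique : ∀ y → Centroid G w y → y ≡ c
    unique y cy with y ≟ c
    ... | yes y≡c = y≡c
    ... | no y≢c  = ⊥-elim (<⇒≱ (others-heavier y≢c) (centroid⇒hs-minimal cy c))

  middle-of-three-centroids-is-central : ∀ {a b c} → Adj G a c → Adj G c b → a ≢ b → ¬ Adj G a b →
    Centroid G w a → Centroid G w b → Centroid G w c →
    (∀ y → Centroid G w y → y ≡ a ⊎ y ≡ b ⊎ y ≡ c) →
    Central G w c × (∀ y → Central G w y → y ≡ c)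
  middle-of-three-centroids-is-central {a} {b} {c} ac cb a≢b ¬ab
                                       centroid-a centroid-b centroid-c centroids =
    (centroid-c , 1 , ecc-c , ecc≥1) , unique
    where
    ecc-c : EccCent G w c 1
    ecc-c = within-1 , a , centroid-a , dist-adjacent (adj-sym ac)
      where
      within-1 : ∀ y d → Centroid G w y → Dist G c y d → d ≤ 1
      within-1 y d cy (_ , shortest) with centroids y cy
      ... | inj₁ refl        = shortest 1 (proj₁ (dist-adjacent (adj-sym ac)))
      ... | inj₂ (inj₁ refl) = shortest 1 (proj₁ (dist-adjacent cb))
      ... | inj₂ (inj₂ refl) = ≤-trans (shortest 0 (here refl)) z≤n
    ecc≥1 : ∀ y e → Centroid G w y → EccCent G w y e → 1 ≤ e
    ecc≥1 y e cy (within , _) with centroids y cy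
    ... | inj₁ refl        = within c 1 centroid-c (dist-adjacent ac)
    ... | inj₂ (inj₁ refl) = within c 1 centroid-c (dist-adjacent (adj-sym cb))
    ... | inj₂ (inj₂ refl) = within a 1 centroid-a (dist-adjacent (adj-sym ac))
    unique : ∀ y → Central G w y → y ≡ c
    unique y (cy , e , (within , _) , minimal) with centroids y cy
    ... | inj₁ refl        = ⊥-elim (<⇒≱ (within b 2 centroid-b (dist-two ac cb a≢b ¬ab))
                                          (minimal c 1 centroid-c ecc-c))
    ... | inj₂ (inj₁ refl) = ⊥-elim (<⇒≱ (within a 2 centroid-a (dist-two (adj-sym cb) (adj-sym ac) b≢a ¬ba))
                                          (minimal c 1 centroid-c ecc-c))
      where
      b≢a : b ≢ a
      b≢a b≡a = a≢b (sym b≡a)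
      ¬ba : ¬ Adj G b a
      ¬ba ba = ¬ab (adj-sym ba)
    ... | inj₂ (inj₂ refl) = refl

module CanonicalTrees {m} (G : Graph m) (w : Weight m) (T : IsTree G) (canonical : Canonical G w) where

  open WeightedTrees G w T public
  open Canonical canonical

  another-neighbour : ∀ {x y} → w x ≡ 0 → Adj G x y → ∃[ y′ ] (Adj G x y′ × y′ ≢ y)
  another-neighbour {x} {y} wx≡0 xy with any? (λ z → adj? x z ×-dec ¬? (z ≟ y))
  ... | yes found = found
  ... | no ∄ = ⊥-elim (<-irrefl (sym wx≡0) (leafWeight x leaf))
    where
    only-y : ∀ z → Adj G x z → z ∈ singleton y
    only-y z xz with z ≟ y
    ... | yes _   = refl
    ... | no z≢y = ⊥-elim (∄ (z , xz , z≢y))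
    neighbours≗y : G x ≗ singleton y
    neighbours≗y z = ⇔→≡ (mk⇔ (only-y z) (λ z≡y → subst (Adj G x) (sym (∈-singleton z≡y)) xy))
    leaf : Leaf G x
    leaf = trans (sumFin-cong (λ z → cong (λ b → if b then 1 else 0) (neighbours≗y z)))
                 (sumFin-singleton y (λ _ → 1))

  -- One-sided lemmas; BalancedEdge uses them for both orientations of the edge.
  module OrientedBalancedEdge {c u h} (cu : Adj G c u) (2h≡n : 2 * h ≡ n)
                              (c-side : wt w (branch u c) ≡ h) (u-side : wt w (branch c u) ≡ h) where

    c≢u : c ≢ u
    c≢u = adj-irrefl cu

    u≢c : u ≢ c
    u≢c = adj-irrefl (adj-sym cu)

    h≤hs : ∀ y → h ≤ hs y
    h≤hs y with edge-sides-cover cu y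
    ... | inj₁ y∈c-side = subst (_≤ hs y) u-side (opposite-side≤hs (adj-sym cu) y∈c-side)
    ... | inj₂ y∈u-side = subst (_≤ hs y) c-side (opposite-side≤hs cu y∈u-side)

    hs≤⇒centroid : ∀ {y} → hs y ≤ h → Centroid G w y
    hs≤⇒centroid hs-y≤h = hs-minimal⇒centroid (λ z → ≤-trans hs-y≤h (h≤hs z))

    hs-u≤ : hs u ≤ h
    hs-u≤ = hs≤-via-edge cu (≤-reflexive c-side) (≤-reflexive u-side)

    centroid⇒hs≤ : ∀ {y} → Centroid G w y → hs y ≤ h
    centroid⇒hs≤ cy = ≤-trans (centroid⇒hs-minimal cy u) hs-u≤

    u∈branch-towards-c : ∀ {y} → y ≢ c → y ≢ u → u ∈ branch y c
    u∈branch-towards-c y≢c y≢u =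
      branch-closed (branch-∋ (λ c≡y → y≢c (sym c≡y))) cu (λ u≡y → y≢u (sym u≡y))

    -- The subtree of y containing c already carries the whole c-side, of weight h ≥ hs y.
    zero-weight-beyond : ∀ {y z} → y ∈ branch c u → hs y ≤ h → z ∈ branch y c → z ∉ branch u c → w z ≡ 0
    zero-weight-beyond {y} {z} y∈ hs-y≤h z∈ z∉ = m+n≤m⇒n≡0 h (begin
      h + w z                  ≡⟨ cong (_+ w z) (sym c-side) ⟩
      wt w (branch u c) + w z  ≤⟨ wt-insert z∉ (opposite-side⊆branch cu y∈) z∈ ⟩
      wt w (branch y c)        ≤⟨ branch≤hs y c ⟩
      hs y                     ≤⟨ hs-y≤h ⟩
      h                        ∎)
      where open ≤-Reasoning

    third-centroid : ∀ {x} → x ∈ branch c u → x ≢ u → hs x ≤ h → w u ≡ 0 × Adj G u x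
    third-centroid {x} x∈ x≢u hs-x≤h = wu≡0 , ux
      where
      x≢c : x ≢ c
      x≢c = ∈branch⇒≢ x∈
      wu≡0 : w u ≡ 0
      wu≡0 = zero-weight-beyond x∈ hs-x≤h (u∈branch-towards-c x≢c x≢u) (¬-not (λ u∈ → ∈branch⇒≢ u∈ refl))
      ux : Adj G u x
      ux with neighbour-towards x≢u
      ... | z , uz , x∈z with z ≟ x
      ...   | yes refl = uz
      ...   | no z≢x with z ≟ c
      ...     | yes refl = ⊥-elim (edge-sides-disjoint cu x x∈z x∈)
      ...     | no z≢c = ⊥-elim (zeroIndep u z uz wu≡0 (zero-weight-beyond x∈ hs-x≤h z∈x-branch z∉c-side))
        where
        z∈x-branch : z ∈ branch x c
        z∈x-branch = branch-closed (u∈branch-towards-c x≢c x≢u) uz (λ z≡x → z≢x z≡x)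
        z∉c-side : z ∉ branch u c
        z∉c-side = ¬-not (λ z∈ → edge-sides-disjoint cu z z∈ (branch-closed (branch-∋ u≢c) uz z≢c))

    NoThirdCentroid : Set
    NoThirdCentroid = ∀ y → hs y ≤ h → y ≡ c ⊎ y ≡ u

    c-side-closed : ∀ {x y} → x ∈ branch u c → x ≢ c → Adj G x y → y ∈ branch u c
    c-side-closed {x} {y} x∈ x≢c xy with y ≟ u
    ... | yes refl = ⊥-elim (edge-sides-disjoint cu x x∈ (branch-closed (branch-∋ u≢c) (adj-sym xy) x≢c))
    ... | no y≢u   = branch-closed x∈ xy y≢u

    sole-other-neighbour-is-light : ∀ {y} → w c ≡ 0 → Adj G c y → y ≢ u →
      (∀ z → Adj G c z → z ≢ u → z ≡ y) → hs y ≤ h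
    sole-other-neighbour-is-light {y} wc≡0 cy y≢u sole =
      hs≤-via-edge cy (half≤⇒≤half (trans (edge-sides-weight cy) (sym 2h≡n)) h≤y-branch) y-branch≤h
      where
      y-branch⊆c-side : branch c y ⊆ branch u c
      y-branch⊆c-side = branch-nested (adj-sym cu) (branch-closed (branch-∋ c≢u) cy y≢u)
      y-branch≤h : wt w (branch c y) ≤ h
      y-branch≤h = subst (wt w (branch c y) ≤_) c-side (wt-mono y-branch⊆c-side)
      cover : ∀ t → t ∈ branch u c → t ∈ singleton c ⊎ t ∈ branch c y
      cover t t∈ with t ≟ c
      ... | yes _   = inj₁ refl
      ... | no t≢c with neighbour-towards t≢c
      ...   | z , cz , t∈z with z ≟ u
      ...     | yes refl = ⊥-elim (edge-sides-disjoint cu t t∈ t∈z)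
      ...     | no z≢u rewrite sole z cz z≢u = inj₂ t∈z
      h≤y-branch : h ≤ wt w (branch c y)
      h≤y-branch = begin
        h                                       ≡⟨ sym c-side ⟩
        wt w (branch u c)                       ≤⟨ wt-cover cover ⟩
        wt w (singleton c) + wt w (branch c y)  ≡⟨ cong (_+ wt w (branch c y)) (wt-singleton c) ⟩
        w c + wt w (branch c y)                 ≡⟨ cong (_+ wt w (branch c y)) wc≡0 ⟩
        wt w (branch c y)                       ∎
        where open ≤-Reasoning

    TwoNeighboursInside : Fin m → Set
    TwoNeighboursInside x =
      ∃[ y₁ ] ∃[ y₂ ] (y₁ ≢ y₂ × Adj G x y₁ × Adj G x y₂ × y₁ ∈ branch u c × y₂ ∈ branch u c)

    zero-c-has-two-neighbours-inside : NoThirdCentroid → w c ≡ 0 → TwoNeighboursInside c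
    zero-c-has-two-neighbours-inside none wc≡0 with another-neighbour wc≡0 cu
    ... | y₁ , cy₁ , y₁≢u with any? (λ z → adj? c z ×-dec (¬? (z ≟ u) ×-dec ¬? (z ≟ y₁)))
    ...   | yes (y₂ , cy₂ , y₂≢u , y₂≢y₁) =
            y₁ , y₂ , (λ y₁≡y₂ → y₂≢y₁ (sym y₁≡y₂)) , cy₁ , cy₂ ,
            branch-closed (branch-∋ c≢u) cy₁ y₁≢u , branch-closed (branch-∋ c≢u) cy₂ y₂≢u
    ...   | no ∄ = ⊥-elim (neither-c-nor-u (none y₁ (sole-other-neighbour-is-light wc≡0 cy₁ y₁≢u sole)))
      where
      sole : ∀ z → Adj G c z → z ≢ u → z ≡ y₁
      sole z cz z≢u with z ≟ y₁
      ... | yes z≡y₁ = z≡y₁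
      ... | no z≢y₁  = ⊥-elim (∄ (z , cz , z≢u , z≢y₁))
      neither-c-nor-u : y₁ ≡ c ⊎ y₁ ≡ u → ⊥
      neither-c-nor-u (inj₁ refl) = adj-irrefl cy₁ refl
      neither-c-nor-u (inj₂ refl) = y₁≢u refl

    zero-vertex-has-two-neighbours-inside : NoThirdCentroid → ∀ {x} → x ∈ branch u c → w x ≡ 0 →
      TwoNeighboursInside x
    zero-vertex-has-two-neighbours-inside none {x} x∈ wx≡0 with x ≟ c
    ... | yes refl = zero-c-has-two-neighbours-inside none wx≡0
    ... | no x≢c with neighbour-towards (λ c≡x → x≢c (sym c≡x))
    ...   | y₁ , xy₁ , _ with another-neighbour wx≡0 xy₁
    ...     | y₂ , xy₂ , y₂≢y₁ =
              y₁ , y₂ , (λ y₁≡y₂ → y₂≢y₁ (sym y₁≡y₂)) , xy₁ , xy₂ ,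
              c-side-closed x∈ x≢c xy₁ , c-side-closed x∈ x≢c xy₂

    -- A missed vertex of weight 0 has two neighbours in the c-side, both of positive weight,
    -- and the connected set S contains at most one of them.
    proper-subtree-misses-positive : NoThirdCentroid → ∀ {S} → ProperSubtree G (branch u c) S →
      ∃[ y ] (y ∈ branch u c × y ∉ S × 0 < w y)
    proper-subtree-misses-positive none {S} (_ , (x , x∈ , x∉S) , _ , S-connected) with w x ≟ℕ 0
    ... | no wx≢0 = x , x∈ , x∉S , n≢0⇒n>0 wx≢0
    ... | yes wx≡0 with zero-vertex-has-two-neighbours-inside none x∈ wx≡0
    ...   | y₁ , y₂ , y₁≢y₂ , xy₁ , xy₂ , y₁∈ , y₂∈ with S y₁ in Sy₁ | S y₂ in Sy₂
    ...     | false | _     = y₁ , y₁∈ , Sy₁ , n≢0⇒n>0 (zeroIndep x y₁ xy₁ wx≡0)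
    ...     | true  | false = y₂ , y₂∈ , Sy₂ , n≢0⇒n>0 (zeroIndep x y₂ xy₂ wx≡0)
    ...     | true  | true  =
              ⊥-elim (y₁≢y₂ (connected-set-single-neighbour S-connected x∉S Sy₁ Sy₂ xy₁ xy₂))

    proper-subtree-light : NoThirdCentroid → ∀ {S} → ProperSubtree G (branch u c) S → 2 * (wt w S + 1) ≤ n
    proper-subtree-light none {S} S-proper@(S⊆ , _) with proper-subtree-misses-positive none S-proper
    ... | y , y∈ , y∉S , 0<wy = subst (2 * (wt w S + 1) ≤_) 2h≡n (*-monoʳ-≤ 2 (begin
      wt w S + 1         ≤⟨ +-monoʳ-≤ (wt w S) 0<wy ⟩
      wt w S + w y       ≤⟨ wt-insert y∉S S⊆ y∈ ⟩
      wt w (branch u c)  ≡⟨ c-side ⟩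
      h                  ∎))
      where open ≤-Reasoning

  module BalancedEdge {c u h} (cu : Adj G c u) (2h≡n : 2 * h ≡ n)
                      (c-side : wt w (branch u c) ≡ h) (u-side : wt w (branch c u) ≡ h) where

    open OrientedBalancedEdge cu 2h≡n c-side u-side public
    private
      module Flipped = OrientedBalancedEdge (adj-sym cu) 2h≡n u-side c-side

    edge-split : EdgeSplit G c u (branch u c) (branch c u)
    edge-split = branch-∋ c≢u , branch-∋ u≢c , exclusive , branch-connected , branch-connected , cross
      where
      exclusive : ∀ x → (x ∈ branch u c × x ∉ branch c u) ⊎ (x ∉ branch u c × x ∈ branch c u)
      exclusive x with edge-sides-cover cu x
      ... | inj₁ x∈ = inj₁ (x∈ , ¬-not (edge-sides-disjoint cu x x∈))
      ... | inj₂ x∈ = inj₂ (¬-not (λ x∈′ → edge-sides-disjoint cu x x∈′ x∈) , x∈)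
      cross : ∀ a b → a ∈ branch u c → b ∈ branch c u → Adj G a b → a ≡ c × b ≡ u
      cross a b a∈ b∈ ab with a ≟ c | b ≟ u
      ... | yes a≡c | yes b≡u = a≡c , b≡u
      ... | _       | no b≢u  = ⊥-elim (edge-sides-disjoint cu b (branch-closed a∈ ab b≢u) b∈)
      ... | no a≢c  | _       = ⊥-elim (edge-sides-disjoint cu a a∈ (branch-closed b∈ (adj-sym ab) a≢c))

    case2 : NoThirdCentroid → Case2 G w
    case2 none =
      c , u , c≢u , hs≤⇒centroid Flipped.hs-u≤ , hs≤⇒centroid hs-u≤ ,
      (λ y cy → none y (centroid⇒hs≤ cy)) , cu ,
      branch u c , branch c u , edge-split ,
      trans (cong (2 *_) c-side) 2h≡n , trans (cong (2 *_) u-side) 2h≡n ,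
      (λ S → proper-subtree-light none) ,
      (λ S → Flipped.proper-subtree-light (λ y hs-y≤h → swap (none y hs-y≤h)))

    module ThirdCentroid {x} (x∈ : x ∈ branch c u) (x≢u : x ≢ u) (hs-x≤h : hs x ≤ h) where

      wu≡0 : w u ≡ 0
      wu≡0 = proj₁ (third-centroid x∈ x≢u hs-x≤h)

      ux : Adj G u x
      ux = proj₂ (third-centroid x∈ x≢u hs-x≤h)

      x≢c : x ≢ c
      x≢c = ∈branch⇒≢ x∈

      x∉c-side : ¬ x ∈ branch u c
      x∉c-side x∈′ = edge-sides-disjoint cu x x∈′ x∈

      c∉x-side : ¬ c ∈ branch u x
      c∉x-side c∈ = x∉c-side (trans (∈branch⇒same-branch c∈ x) (branch-∋ x≢u))

      c-side∩x-side : Disjoint (branch u c) (branch u x)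
      c-side∩x-side = branches-disjoint c∉x-side

      centroids : ∀ y → Centroid G w y → y ≡ c ⊎ y ≡ x ⊎ y ≡ u
      centroids y cy with y ≟ c | y ≟ x | y ≟ u
      ... | yes y≡c | _       | _       = inj₁ y≡c
      ... | no _    | yes y≡x | _       = inj₂ (inj₁ y≡x)
      ... | no _    | no _    | yes y≡u = inj₂ (inj₂ y≡u)
      ... | no y≢c  | no y≢x  | no y≢u with edge-sides-cover cu y
      ...   | inj₁ y∈c-side = ⊥-elim (zeroIndep c u cu wc≡0 wu≡0)
        where
        wc≡0 : w c ≡ 0
        wc≡0 = proj₁ (Flipped.third-centroid y∈c-side y≢c (centroid⇒hs≤ cy))
      ...   | inj₂ y∈u-side =
                ⊥-elim (zeroIndep u x ux wu≡0 (zero-weight-beyond y∈u-side (centroid⇒hs≤ cy)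
                          (branch-closed (u∈branch-towards-c y≢c y≢u) ux (λ x≡y → y≢x (sym x≡y)))
                          (¬-not x∉c-side)))

      x-side : wt w (branch u x) ≡ h
      x-side = ≤-antisym x-side≤h h≤x-side
        where
        open ≤-Reasoning
        x-side≤h : wt w (branch u x) ≤ h
        x-side≤h = +-cancelˡ-≤ h _ h (begin
          h + wt w (branch u x)                  ≡⟨ cong (_+ wt w (branch u x)) (sym c-side) ⟩
          wt w (branch u c) + wt w (branch u x)  ≤⟨ wt-disjoint c-side∩x-side (λ _ _ → refl) (λ _ _ → refl) ⟩
          n                                      ≡⟨ trans (sym 2h≡n) (double h) ⟩
          h + h                                  ∎)
        h≤x-side : h ≤ wt w (branch u x)
        h≤x-side = ≤half⇒half≤ (trans (edge-sides-weight ux) (sym 2h≡n)) (≤-trans (branch≤hs x u) hs-x≤h)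

      -- A third subtree of u would be rooted at a neighbour of positive weight, on top of 2h = n.
      no-third-side : ∀ {y} → Adj G u y → ¬ y ∈ branch u c → ¬ y ∈ branch u x → ⊥
      no-third-side {y} uy y∉c-side y∉x-side = zeroIndep u y uy wu≡0 (m+n≤m⇒n≡0 n (begin
        n + w y                                      ≡⟨ cong (_+ w y) (trans (sym 2h≡n) (double h)) ⟩
        h + h + w y                                  ≡⟨ cong₂ (λ a b → a + b + w y) (sym c-side) (sym x-side) ⟩
        wt w (branch u c) + wt w (branch u x) + w y  ≤⟨ +-monoˡ-≤ (w y) sides≤T∖y ⟩
        wt w (T∖ y) + w y                            ≤⟨ wt-insert y∉T∖y (λ _ _ → refl) refl ⟩
        n                                            ∎))
        where
        open ≤-Reasoning
        avoids : ∀ {U} → ¬ y ∈ U → U ⊆ T∖ y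
        avoids y∉U t t∈ = T∖-intro {y} {t} (λ { refl → y∉U t∈ })
        y∉T∖y : y ∉ T∖ y
        y∉T∖y = ¬-not (λ y∈ → T∖-≢ {y} y∈ refl)
        sides≤T∖y : wt w (branch u c) + wt w (branch u x) ≤ wt w (T∖ y)
        sides≤T∖y = wt-disjoint c-side∩x-side (avoids y∉c-side) (avoids y∉x-side)

      components : ∀ C → Comp G u C → C ≗ branch u c ⊎ C ≗ branch u x
      components C cp with comp≗neighbour-branch cp
      ... | y , uy , C≗y with branch u c y in y-c | branch u x y in y-x
      ...   | true  | _     = inj₁ (λ t → trans (C≗y t) (∈branch⇒same-branch y-c t))
      ...   | false | true  = inj₂ (λ t → trans (C≗y t) (∈branch⇒same-branch y-x t))
      ...   | false | false = ⊥-elim (no-third-side uy (∉⇒¬∈ y-c) (∉⇒¬∈ y-x))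

      case3 : Case3 G w
      case3 =
        c , x , u , (λ c≡x → x≢c (sym c≡x)) , c≢u , x≢u ,
        centroid-c , centroid-x , centroid-u , centroids ,
        proj₁ u-central , proj₂ u-central , wu≡0 ,
        branch u c , branch u x , branch-comp c≢u , branch-comp x≢u ,
        (c , λ same → c∉x-side (trans (sym same) (branch-∋ c≢u))) ,
        components ,
        trans (cong (2 *_) c-side) 2h≡n , trans (cong (2 *_) x-side) 2h≡n
        where
        centroid-c = hs≤⇒centroid Flipped.hs-u≤
        centroid-x = hs≤⇒centroid hs-x≤h
        centroid-u = hs≤⇒centroid hs-u≤
        u-central = middle-of-three-centroids-is-central cu ux (λ c≡x → x≢c (sym c≡x))
          (λ cx → x≢u (branch-neighbour-unique cu x∈ (adj-sym cx)))
          centroid-c centroid-x centroid-u centroids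

  balanced-edge-cases : ∀ {c u h} → Adj G c u → 2 * h ≡ n →
    wt w (branch u c) ≡ h → wt w (branch c u) ≡ h → Case2 G w ⊎ Case3 G w
  balanced-edge-cases {c} {u} {h} cu 2h≡n c-side u-side
    with any? (λ y → hs y ≤? h ×-dec (¬? (y ≟ c) ×-dec ¬? (y ≟ u)))
  ... | yes (y , hs-y≤h , y≢c , y≢u) with edge-sides-cover cu y
  ...   | inj₂ y∈u-side =
          inj₂ (BalancedEdge.ThirdCentroid.case3 cu 2h≡n c-side u-side y∈u-side y≢u hs-y≤h)
  ...   | inj₁ y∈c-side =
          inj₂ (BalancedEdge.ThirdCentroid.case3 (adj-sym cu) 2h≡n u-side c-side y∈c-side y≢c hs-y≤h)
  balanced-edge-cases {c} {u} {h} cu 2h≡n c-side u-side | no ∄ = inj₁ (case2 none)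
    where
    open BalancedEdge cu 2h≡n c-side u-side
    none : NoThirdCentroid
    none y hs-y≤h with y ≟ c | y ≟ u
    ... | yes y≡c | _       = inj₁ y≡c
    ... | no _    | yes y≡u = inj₂ y≡u
    ... | no y≢c  | no y≢u  = ⊥-elim (∄ (y , hs-y≤h , y≢c , y≢u))

  cases : ∃[ v ] 0 < w v → Case1 G w ⊎ Case2 G w ⊎ Case3 G w
  cases (v , 0<wv) with light-vertex v
  ... | x , 2hs≤n with 2 * hs x <? n
  ...   | yes strict = inj₁ (strictly-light⇒case1 strict)
  ...   | no ¬strict =
          let 2h≡n = ≤-antisym 2hs≤n (≮⇒≥ ¬strict)
              (u , xu , x-side , u-side) = balanced-heaviest-edge (≤-trans 0<wv (w≤wt {full} refl)) 2h≡n
          in  inj₂ (balanced-edge-cases xu 2h≡n x-side u-side)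

case1-excludes-case2 : ∀ {m} (G : Graph m) (w : Weight m) → ¬ (Case1 G w × Case2 G w)
case1-excludes-case2 G w ((c , _ , unique , _) , (c₁ , c₂ , c₁≢c₂ , cc₁ , cc₂ , _)) =
  c₁≢c₂ (trans (unique c₁ cc₁) (sym (unique c₂ cc₂)))

case1-excludes-case3 : ∀ {m} (G : Graph m) (w : Weight m) → ¬ (Case1 G w × Case3 G w)
case1-excludes-case3 G w ((c , _ , unique , _) , (a , b , _ , a≢b , _ , _ , ca , cb , _)) =
  a≢b (trans (unique a ca) (sym (unique b cb)))

case2-excludes-case3 : ∀ {m} (G : Graph m) (w : Weight m) → ¬ (Case2 G w × Case3 G w)
case2-excludes-case3 G w ((_ , _ , _ , _ , _ , two , _) ,
                          (a , b , c , a≢b , a≢c , b≢c , ca , cb , cc , _)) =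
  pigeon (two a ca) (two b cb) (two c cc)
  where
  pigeon : _ → _ → _ → ⊥
  pigeon (inj₁ p) (inj₁ q) _        = a≢b (trans p (sym q))
  pigeon (inj₂ p) (inj₂ q) _        = a≢b (trans p (sym q))
  pigeon (inj₁ p) _        (inj₁ r) = a≢c (trans p (sym r))
  pigeon (inj₂ p) _        (inj₂ r) = a≢c (trans p (sym r))
  pigeon _        (inj₁ q) (inj₁ r) = b≢c (trans q (sym r))
  pigeon _        (inj₂ q) (inj₂ r) = b≢c (trans q (sym r))

corollary2 : ∀ {m} (G : Graph m) (w : Weight m) →
    WeightedTree G w → Canonical G w →
    ExactlyOne (Case1 G w) (Case2 G w) (Case3 G w)
corollary2 G w weighted canonical =
  CanonicalTrees.cases G w (WeightedTree.tree weighted) canonical (WeightedTree.positive weighted) ,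
  case1-excludes-case2 G w , case1-excludes-case3 G w , case2-excludes-case3 G w
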